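{- Let $n\geq 3$ and let $r_1\geq r_2\geq\cdots\geq r_n\geq 1$ be integers. If $\sum_{i=3}^{n} r_i\geq n+1$, then $Par(r_1,\ldots,r_n)\notin\mathfrak{N}$.
   Context: Multigraphs are finite and may have multiple edges but no loops. An interval $t$-coloring of a multigraph $G$ is a proper edge-coloring (edges sharing an endpoint get distinct colors) with colors $1,\ldots,t$ such that every color is used and for every vertex $v$ the set of colors of edges incident to $v$ is an interval of integers. $\mathfrak{N}$ denotes the set of multigraphs having an interval $t$-coloring for some positive integer $t$. The parachute multigraph $Par(r_1,\ldots,r_n)$ has vertex set $\{u,w,v_1,\ldots,v_n\}$, with exactly $r_i$ parallel edges between $u$ and $v_i$ for each $1\leq i\leq n$, and exactly one edge between $v_j$ and $w$ for each $1\leq j\leq n$; there are no other edges. -}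

module Defs where

open import Data.Nat using (ℕ; zero; suc; _+_; _≤_; _<_)
open import Data.Fin using (Fin; toℕ) renaming (zero to fzero; suc to fsuc)
open import Data.List using (List; []; _∷_; _++_; length; map; concatMap; replicate; lookup; allFin)
open import Data.Product using (_×_; _,_; proj₁; proj₂; ∃; ∃-syntax)
open import Data.Sum using (_⊎_)
open import Relation.Binary.PropositionalEquality using (_≡_; _≢_)

-- A finite multigraph: vertices Fin V, edges listed (with multiplicity) as
-- pairs of distinct endpoints.  Edge identity = position in the list.
record Multigraph : Set where
  field
    V      : ℕ
    edges  : List (Fin V × Fin V)
    noLoop : ∀ (e : Fin (length edges)) →
               proj₁ (lookup edges e) ≢ proj₂ (lookup edges e)

module _ (G : Multigraph) where
  open Multigraph G

  Edge : Set
  Edge = Fin (length edges)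

  Incident : Edge → Fin V → Set
  Incident e v = proj₁ (lookup edges e) ≡ v ⊎ proj₂ (lookup edges e) ≡ v

  record IntervalColoring (t : ℕ) (c : Edge → ℕ) : Set where
    field
      range    : ∀ e → 1 ≤ c e × c e ≤ t
      proper   : ∀ e e′ v → e ≢ e′ → Incident e v → Incident e′ v → c e ≢ c e′
      allUsed  : ∀ k → 1 ≤ k → k ≤ t → ∃[ e ] c e ≡ k
      interval : ∀ v e₁ e₂ k → Incident e₁ v → Incident e₂ v →
                   c e₁ ≤ k → k ≤ c e₂ → ∃[ e ] (Incident e v × c e ≡ k)

InN : Multigraph → Set
InN G = ∃[ t ] (1 ≤ t × ∃[ c ] IntervalColoring G t c)

-- Parachute Par(r_1,…,r_n): vertices u = 0, w = 1, v_i = 2 + i  (i : Fin n, 0-based)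
parU parW : ∀ {n} → Fin (2 + n)
parU = fzero
parW = fsuc fzero

parV : ∀ {n} → Fin n → Fin (2 + n)
parV i = fsuc (fsuc i)

parEdges : (n : ℕ) → (Fin n → ℕ) → List (Fin (2 + n) × Fin (2 + n))
parEdges n r = concatMap (λ i → replicate (r i) (parU , parV i)) (allFin n)
               ++ map (λ i → (parV i , parW)) (allFin n)

private
  data AllDistinct {V : ℕ} : List (Fin V × Fin V) → Set where
    []  : AllDistinct []
    _∷_ : ∀ {x xs} → proj₁ x ≢ proj₂ x → AllDistinct xs → AllDistinct (x ∷ xs)

  lookupAD : ∀ {V} {xs : List (Fin V × Fin V)} → AllDistinct xs →
             ∀ (e : Fin (length xs)) → proj₁ (lookup xs e) ≢ proj₂ (lookup xs e)
  lookupAD (p ∷ _) fzero = p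
  lookupAD (_ ∷ ps) (fsuc e) = lookupAD ps e

  ad++ : ∀ {V} {xs ys : List (Fin V × Fin V)} → AllDistinct xs → AllDistinct ys → AllDistinct (xs ++ ys)
  ad++ [] q = q
  ad++ (p ∷ ps) q = p ∷ ad++ ps q

  adRep : ∀ {n} (k : ℕ) (i : Fin n) → AllDistinct (replicate k (parU {n} , parV i))
  adRep zero i = []
  adRep (suc k) i = (λ ()) ∷ adRep k i

  adL : ∀ {n} (r : Fin n → ℕ) (is : List (Fin n)) →
        AllDistinct (concatMap (λ i → replicate (r i) (parU , parV i)) is)
  adL r [] = []
  adL r (i ∷ is) = ad++ (adRep (r i) i) (adL r is)

  adR : ∀ {n} (is : List (Fin n)) → AllDistinct (map (λ i → (parV i , parW {n})) is)
  adR [] = []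
  adR (i ∷ is) = (λ ()) ∷ adR is

Par : (n : ℕ) → (Fin n → ℕ) → Multigraph
Par n r = record
  { V = 2 + n
  ; edges = parEdges n r
  ; noLoop = lookupAD (ad++ (adL r (allFin n)) (adR (allFin n)))
  }

module Submission where

-- Let Par(r₁,…,rₙ) have hub u, apex w and middle vertices vᵢ, joined to u
-- by rᵢ parallel "spokes" and to w by a single "leg".  Fix an interval
-- colouring c.  Call a spoke low (high) if its colour is below (above)
-- every colour at w.
--   * Two low spokes end at the same vᵢ: if e ends at vᵢ, e′ at vⱼ ≠ vᵢ and
--     c e ≤ c e′ < c(legᵢ), the interval at vᵢ contains c e′, so c e′ is
--     the colour of a spoke at vᵢ (impossible at u) or of legᵢ (impossible,
--     it is below all colours at w).  Symmetrically for high spokes.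
--   * A spoke that is neither low nor high has its colour between two
--     colours at w, hence (interval at w) equal to a colour at w.

open import Defs
open import Data.Nat using (ℕ; zero; suc; _+_; _≤_; _<_; z≤n; s≤s; _<?_)
open import Data.Nat.Properties
  using (≤-trans; ≤-reflexive; ≤-total; <⇒≤; <-irrefl; ≮⇒≥; <-cmp; +-suc; +-assoc;
         +-identityʳ; +-comm; +-mono-≤; +-monoˡ-≤; +-cancelˡ-≤; m≤m+n; m+1+n≰m; module ≤-Reasoning)
open import Data.Nat.ListAction using (sum)
open import Data.Fin using (Fin; toℕ) renaming (zero to fzero; suc to fsuc)
import Data.Fin.Properties as Fin
open import Data.List using (List; []; _∷_; _++_; length; map; drop; allFin; filter; concatMap; replicate; lookup)
open import Data.List.Properties using (length-++; length-map; length-replicate; length-filter; filter-++; filter-all; filter-none; map-tabulate; tabulate-lookup; length-tabulate)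
open import Data.List.Membership.Propositional using (_∈_)
open import Data.List.Membership.Propositional.Properties
  using (∈-∃++; ∈-++⁻; ∈-++⁺ˡ; ∈-++⁺ʳ; ∈-map⁺; ∈-map⁻; ∈-filter⁺; ∈-filter⁻; ∈-allFin; ∈-lookup)
open import Data.List.Relation.Binary.Subset.Propositional using (_⊆_)
open import Data.List.Relation.Unary.Any using (here; there)
import Data.List.Relation.Unary.Any as Any
open import Data.List.Relation.Unary.Any.Properties using (lookup-index)
open import Data.List.Relation.Unary.All using (All; []; _∷_)
import Data.List.Relation.Unary.All as All
open import Data.List.Relation.Unary.AllPairs using (AllPairs; []; _∷_)
import Data.List.Relation.Unary.AllPairs.Properties as AllPairs
open import Data.List.Relation.Unary.Unique.Propositional using (Unique)
open import Data.List.Relation.Unary.Unique.Propositional.Properties using (allFin⁺)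
open import Data.Product using (_×_; _,_; proj₁; proj₂; ∃; ∃-syntax)
open import Data.Product.Properties using (≡-dec)
open import Data.Sum using (_⊎_; inj₁; inj₂)
open import Data.Empty using (⊥-elim)
open import Data.Bool using (true; false)
open import Function using (_∘_)
open import Level using () renaming (zero to ℓ₀)
open import Relation.Binary using (Rel; tri<; tri≈; tri>)
open import Relation.Binary.PropositionalEquality using (_≡_; _≢_; refl; sym; trans; cong; cong₂; subst)
open import Relation.Nullary using (¬_; Dec; yes; no; does)
open import Relation.Nullary.Decidable using (_⊎-dec_; _×-dec_; _→-dec_)
open import Relation.Unary using (Pred; Decidable)

module _ {A : Set} where

  ∈-delete : ∀ {y z : A} ys₁ ys₂ → z ∈ ys₁ ++ y ∷ ys₂ → z ≢ y → z ∈ ys₁ ++ ys₂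
  ∈-delete []        ys₂ (here z≡y) z≢y = ⊥-elim (z≢y z≡y)
  ∈-delete []        ys₂ (there z∈) z≢y = z∈
  ∈-delete (_ ∷ ys₁) ys₂ (here z≡x) z≢y = here z≡x
  ∈-delete (_ ∷ ys₁) ys₂ (there z∈) z≢y = there (∈-delete ys₁ ys₂ z∈ z≢y)

  unique⊆⇒length≤ : ∀ {xs ys : List A} → Unique xs → xs ⊆ ys → length xs ≤ length ys
  unique⊆⇒length≤ {[]}     _             _     = z≤n
  unique⊆⇒length≤ {x ∷ xs} (x∉xs ∷ xs!) xs⊆ys with ∈-∃++ (xs⊆ys (here refl))
  ... | ys₁ , ys₂ , refl = begin
      suc (length xs)                     ≤⟨ s≤s (unique⊆⇒length≤ xs! xs⊆ys₁ys₂) ⟩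
      suc (length (ys₁ ++ ys₂))           ≡⟨ cong suc (length-++ ys₁) ⟩
      suc (length ys₁ + length ys₂)       ≡⟨ sym (+-suc (length ys₁) (length ys₂)) ⟩
      length ys₁ + length (x ∷ ys₂)       ≡⟨ sym (length-++ ys₁) ⟩
      length (ys₁ ++ x ∷ ys₂)             ∎
    where
    open ≤-Reasoning
    xs⊆ys₁ys₂ : xs ⊆ ys₁ ++ ys₂
    xs⊆ys₁ys₂ z∈xs = ∈-delete ys₁ ys₂ (xs⊆ys (there z∈xs)) (λ z≡x → All.lookup x∉xs z∈xs (sym z≡x))

  allPairs-restrict : ∀ {P : Pred A ℓ₀} {R : Rel A ℓ₀} {xs : List A} →
    All P xs → AllPairs (λ a b → P a → P b → R a b) xs → AllPairs R xs
  allPairs-restrict []         []           = []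
  allPairs-restrict (pa ∷ pxs) (ha ∷ hxs) =
    All.zipWith (λ (h , pb) → h pa pb) (ha , pxs) ∷ allPairs-restrict pxs hxs

  ∈-replicate : ∀ k {x y : A} → y ∈ replicate k x → y ≡ x
  ∈-replicate (suc k) (here y≡x) = y≡x
  ∈-replicate (suc k) (there y∈) = ∈-replicate k y∈

  length-filter-++ : ∀ {P : Pred A ℓ₀} (P? : Decidable P) (xs ys : List A) →
    length (filter P? (xs ++ ys)) ≡ length (filter P? xs) + length (filter P? ys)
  length-filter-++ P? xs ys = trans (cong length (filter-++ P? xs ys)) (length-++ (filter P? xs))

module _ {A B : Set} where

  length-filter-map : ∀ {P : Pred B ℓ₀} (P? : Decidable P) (g : A → B) (xs : List A) →
    length (filter (P? ∘ g) xs) ≡ length (filter P? (map g xs))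
  length-filter-map P? g []       = refl
  length-filter-map P? g (x ∷ xs) with does (P? (g x))
  ... | true  = cong suc (length-filter-map P? g xs)
  ... | false = length-filter-map P? g xs

length-filter-lookup : ∀ {A : Set} {P : Pred A ℓ₀} (P? : Decidable P) (xs : List A) →
  length (filter (P? ∘ lookup xs) (allFin (length xs))) ≡ length (filter P? xs)
length-filter-lookup P? xs =
  trans (length-filter-map P? (lookup xs) (allFin (length xs)))
        (cong (length ∘ filter P?) (trans (map-tabulate (λ i → i) (lookup xs)) (tabulate-lookup xs)))

counterexample : ∀ {L} {Q R : Pred (Fin L) ℓ₀} → Decidable Q → Decidable R →
  ¬ (∀ f → Q f → R f) → ∃ λ f → Q f × ¬ R f
counterexample {L} {Q} {R} Q? R? not-all
  with Fin.¬∀⟶∃¬ L (λ f → Q f → R f) (λ f → Q? f →-dec R? f) not-all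
... | f , ¬[Qf→Rf] with Q? f
...   | yes qf = f , qf , λ rf → ¬[Qf→Rf] (λ _ → rf)
...   | no ¬qf = ⊥-elim (¬[Qf→Rf] (⊥-elim ∘ ¬qf))

Touches : ∀ {V} → Fin V → Pred (Fin V × Fin V) ℓ₀
Touches v p = proj₁ p ≡ v ⊎ proj₂ p ≡ v

touches? : ∀ {V} (v : Fin V) → Decidable (Touches v)
touches? v p = (proj₁ p Fin.≟ v) ⊎-dec (proj₂ p Fin.≟ v)

module _ (G : Multigraph) where
  open Multigraph G

  edgesWhere : {P : Pred (Fin V × Fin V) ℓ₀} → Decidable P → List (Edge G)
  edgesWhere P? = filter (P? ∘ lookup edges) (allFin (length edges))

  length-edgesWhere : ∀ {P : Pred (Fin V × Fin V) ℓ₀} (P? : Decidable P) →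
    length (edgesWhere P?) ≡ length (filter P? edges)
  length-edgesWhere P? = length-filter-lookup P? edges

  incident? : ∀ v → Decidable (λ e → Incident G e v)
  incident? v = touches? v ∘ lookup edges

  edgesAt : Fin V → List (Edge G)
  edgesAt v = edgesWhere (touches? v)

  coloursAt : (Edge G → ℕ) → Fin V → List ℕ
  coloursAt c v = map c (edgesAt v)

Between : ℕ → ℕ → ℕ → Set
Between a k b = (a ≤ k × k ≤ b) ⊎ (b ≤ k × k ≤ a)

module IntervalColouringFacts {G : Multigraph} {t : ℕ} {c : Edge G → ℕ}
                              (IC : IntervalColoring G t c) where
  open Multigraph G
  open IntervalColoring IC

  coloursAt-unique : ∀ v → Unique (coloursAt G c v)
  coloursAt-unique v = AllPairs.map⁺ (allPairs-restrict incident pairwise)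
    where
    incident : All (λ e → Incident G e v) (edgesAt G v)
    incident = All.tabulate (proj₂ ∘ ∈-filter⁻ (incident? G v) {xs = allFin (length edges)})
    pairwise : AllPairs (λ e f → Incident G e v → Incident G f v → c e ≢ c f) (edgesAt G v)
    pairwise = AllPairs.filter⁺ _ (AllPairs.tabulate⁺ (λ e≢f → proper _ _ v e≢f))

  colour∈coloursAt : ∀ {e v} → Incident G e v → c e ∈ coloursAt G c v
  colour∈coloursAt {e} {v} inc = ∈-map⁺ c (∈-filter⁺ (incident? G v) (∈-allFin e) inc)

  interval-between : ∀ {v e₁ e₂ k} → Incident G e₁ v → Incident G e₂ v →
    Between (c e₁) k (c e₂) → ∃[ e ] (Incident G e v × c e ≡ k)
  interval-between i₁ i₂ (inj₁ (a , b)) = interval _ _ _ _ i₁ i₂ a b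
  interval-between i₁ i₂ (inj₂ (a , b)) = interval _ _ _ _ i₂ i₁ a b

module ParachuteEdges (n : ℕ) (r : Fin n → ℕ) where

  Pair : Set
  Pair = Fin (2 + n) × Fin (2 + n)

  spoke leg : Fin n → Pair
  spoke i = (parU , parV i)
  leg i = (parV i , parW)

  spokes : List (Fin n) → List Pair
  spokes = concatMap (λ i → replicate (r i) (spoke i))

  legs : List (Fin n) → List Pair
  legs = map leg

  parV-injective : ∀ {i j : Fin n} → parV {n} i ≡ parV j → i ≡ j
  parV-injective = Fin.suc-injective ∘ Fin.suc-injective

  ∈-spokes : ∀ is {p} → p ∈ spokes is → ∃ λ i → p ≡ spoke i
  ∈-spokes (i ∷ is) p∈ with ∈-++⁻ (replicate (r i) (spoke i)) p∈
  ... | inj₁ p∈block = i , ∈-replicate (r i) p∈block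
  ... | inj₂ p∈rest  = ∈-spokes is p∈rest

  ∈-parEdges : ∀ {p} → p ∈ parEdges n r → (∃ λ i → p ≡ spoke i) ⊎ (∃ λ i → p ≡ leg i)
  ∈-parEdges p∈ with ∈-++⁻ (spokes (allFin n)) p∈
  ... | inj₁ p∈spokes = inj₁ (∈-spokes (allFin n) p∈spokes)
  ... | inj₂ p∈legs   = inj₂ (proj₁ (∈-map⁻ leg p∈legs) , proj₂ (proj₂ (∈-map⁻ leg p∈legs)))

  sum≤deg-u : sum (map r (allFin n)) ≤ length (filter (touches? parU) (parEdges n r))
  sum≤deg-u = begin
      sum (map r (allFin n))                                    ≡⟨ sym (length-spokes (allFin n)) ⟩
      length (spokes (allFin n))                                ≡⟨ cong length (sym (filter-all (touches? parU) spokes-touch-u)) ⟩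
      length (filter (touches? parU) (spokes (allFin n)))       ≤⟨ m≤m+n _ _ ⟩
      length (filter (touches? parU) (spokes (allFin n)))
        + length (filter (touches? parU) (legs (allFin n)))     ≡⟨ sym (length-filter-++ (touches? parU) (spokes (allFin n)) _) ⟩
      length (filter (touches? parU) (parEdges n r))            ∎
    where
    open ≤-Reasoning
    length-spokes : ∀ is → length (spokes is) ≡ sum (map r is)
    length-spokes []       = refl
    length-spokes (i ∷ is) = trans (length-++ (replicate (r i) (spoke i)))
                                   (cong₂ _+_ (length-replicate (r i)) (length-spokes is))
    spokes-touch-u : All (Touches parU) (spokes (allFin n))
    spokes-touch-u = All.tabulate λ p∈ → inj₁ (cong proj₁ (proj₂ (∈-spokes (allFin n) p∈)))

  deg-w≤n : length (filter (touches? parW) (parEdges n r)) ≤ n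
  deg-w≤n = begin
      length (filter (touches? parW) (parEdges n r))            ≡⟨ length-filter-++ (touches? parW) (spokes (allFin n)) _ ⟩
      length (filter (touches? parW) (spokes (allFin n)))
        + length (filter (touches? parW) (legs (allFin n)))     ≡⟨ cong (λ l → length l + length (filter (touches? parW) (legs (allFin n)))) (filter-none (touches? parW) spokes-miss-w) ⟩
      length (filter (touches? parW) (legs (allFin n)))         ≤⟨ length-filter (touches? parW) (legs (allFin n)) ⟩
      length (legs (allFin n))                                  ≡⟨ trans (length-map leg (allFin n)) (length-tabulate (λ i → i)) ⟩
      n                                                         ∎
    where
    open ≤-Reasoning
    spoke-misses-w : ∀ {p} → ∃ (λ i → p ≡ spoke i) → ¬ Touches parW p
    spoke-misses-w (i , refl) (inj₁ ())
    spoke-misses-w (i , refl) (inj₂ ())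
    spokes-miss-w : All (λ p → ¬ Touches parW p) (spokes (allFin n))
    spokes-miss-w = All.tabulate (spoke-misses-w ∘ ∈-spokes (allFin n))

  _≟_ : (p q : Pair) → Dec (p ≡ q)
  _≟_ = ≡-dec Fin._≟_ Fin._≟_

  copies : Fin n → List Pair → ℕ
  copies i ps = length (filter (_≟ spoke i) ps)

  copies-++ : ∀ i ps qs → copies i (ps ++ qs) ≡ copies i ps + copies i qs
  copies-++ i = length-filter-++ (_≟ spoke i)

  copies-block≤ : ∀ i j → copies i (replicate (r j) (spoke j)) ≤ r j
  copies-block≤ i j = ≤-trans (length-filter (_≟ spoke i) (replicate (r j) (spoke j)))
                              (≤-reflexive (length-replicate (r j)))

  copies-other-block : ∀ i j → j ≢ i → copies i (replicate (r j) (spoke j)) ≡ 0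
  copies-other-block i j j≢i = cong length (filter-none (_≟ spoke i)
    (All.tabulate λ p∈ p≡ → j≢i (parV-injective (cong proj₂ (trans (sym (∈-replicate (r j) p∈)) p≡)))))

  copies-absent : ∀ i is → All (i ≢_) is → copies i (spokes is) ≡ 0
  copies-absent i []       []             = refl
  copies-absent i (j ∷ is) (i≢j ∷ i∉is) =
    trans (copies-++ i (replicate (r j) (spoke j)) (spokes is))
          (cong₂ _+_ (copies-other-block i j (i≢j ∘ sym)) (copies-absent i is i∉is))

  copies-spokes : ∀ i is → Unique is → copies i (spokes is) ≤ r i
  copies-spokes i []       _              = z≤n
  copies-spokes i (j ∷ is) (j∉is ∷ is!) with j Fin.≟ i
  ... | yes refl = begin
      copies i (spokes (i ∷ is))                                  ≡⟨ copies-++ i (replicate (r i) (spoke i)) (spokes is) ⟩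
      copies i (replicate (r i) (spoke i)) + copies i (spokes is) ≡⟨ cong (_ +_) (copies-absent i is j∉is) ⟩
      copies i (replicate (r i) (spoke i)) + 0                    ≤⟨ +-monoˡ-≤ 0 (copies-block≤ i i) ⟩
      r i + 0                                                     ≡⟨ +-identityʳ (r i) ⟩
      r i                                                         ∎
    where open ≤-Reasoning
  ... | no j≢i = begin
      copies i (spokes (j ∷ is))                                  ≡⟨ copies-++ i (replicate (r j) (spoke j)) (spokes is) ⟩
      copies i (replicate (r j) (spoke j)) + copies i (spokes is) ≡⟨ cong (_+ _) (copies-other-block i j j≢i) ⟩
      copies i (spokes is)                                        ≤⟨ copies-spokes i is is! ⟩
      r i                                                         ∎
    where open ≤-Reasoning

  copies-legs : ∀ i → copies i (legs (allFin n)) ≡ 0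
  copies-legs i = cong length (filter-none (_≟ spoke i) (All.tabulate (leg≢spoke ∘ ∈-map⁻ leg)))
    where
    leg≢spoke : ∀ {p} → ∃ (λ j → j ∈ allFin n × p ≡ leg j) → p ≢ spoke i
    leg≢spoke (j , _ , refl) ()

  spoke-multiplicity : ∀ i → copies i (parEdges n r) ≤ r i
  spoke-multiplicity i = begin
      copies i (parEdges n r)                                     ≡⟨ copies-++ i (spokes (allFin n)) (legs (allFin n)) ⟩
      copies i (spokes (allFin n)) + copies i (legs (allFin n))   ≡⟨ cong (copies i (spokes (allFin n)) +_) (copies-legs i) ⟩
      copies i (spokes (allFin n)) + 0                            ≡⟨ +-identityʳ _ ⟩
      copies i (spokes (allFin n))                                ≤⟨ copies-spokes i (allFin n) (allFin⁺ n) ⟩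
      r i                                                         ∎
    where open ≤-Reasoning

module ParachuteColouring (n : ℕ) (r : Fin n → ℕ) {t : ℕ} {c : Edge (Par n r) → ℕ}
                          (IC : IntervalColoring (Par n r) t c) where
  open ParachuteEdges n r
  open IntervalColoring IC
  open IntervalColouringFacts IC

  G : Multigraph
  G = Par n r

  E : Set
  E = Edge G

  ends : E → Pair
  ends = lookup (parEdges n r)

  incident-by-ends : ∀ {e p v} → ends e ≡ p → Touches v p → Incident G e v
  incident-by-ends {v = v} e≡p = subst (Touches v) (sym e≡p)

  distinct-by-ends : ∀ {e e′} → ends e ≢ ends e′ → e ≢ e′
  distinct-by-ends ends≢ e≡e′ = ends≢ (cong ends e≡e′)

  at-u : ∀ e → Incident G e parU → ∃ λ i → ends e ≡ spoke i
  at-u e inc with ∈-parEdges (∈-lookup e)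
  ... | inj₁ is-spoke = is-spoke
  ... | inj₂ (i , e≡leg) with subst (Touches parU) e≡leg inc
  ...   | inj₁ ()
  ...   | inj₂ ()

  at-v : ∀ e i → Incident G e (parV i) → ends e ≡ spoke i ⊎ ends e ≡ leg i
  at-v e i inc with ∈-parEdges (∈-lookup e)
  ... | inj₁ (j , e≡spoke) with subst (Touches (parV i)) e≡spoke inc
  ...   | inj₁ ()
  ...   | inj₂ vⱼ≡vᵢ = inj₁ (trans e≡spoke (cong spoke (parV-injective vⱼ≡vᵢ)))
  at-v e i inc | inj₂ (j , e≡leg) with subst (Touches (parV i)) e≡leg inc
  ...   | inj₁ vⱼ≡vᵢ = inj₂ (trans e≡leg (cong leg (parV-injective vⱼ≡vᵢ)))
  ...   | inj₂ ()

  legEdge : ∀ i → ∃ λ g → ends g ≡ leg i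
  legEdge i = Any.index leg∈ , sym (lookup-index leg∈)
    where
    leg∈ : leg i ∈ parEdges n r
    leg∈ = ∈-++⁺ʳ (spokes (allFin n)) (∈-map⁺ leg (∈-allFin i))

  legᵢ : Fin n → E
  legᵢ i = proj₁ (legEdge i)

  legᵢ-at-w : ∀ i → Incident G (legᵢ i) parW
  legᵢ-at-w i = incident-by-ends (proj₂ (legEdge i)) (inj₂ refl)

  WColour : ℕ → Set
  WColour k = ∃[ f ] (Incident G f parW × c f ≡ k)

  -- Key step: if a spoke e′ to vⱼ has its colour between those of a spoke
  -- e to vᵢ ≠ vⱼ and of legᵢ, that colour appears at vᵢ, so it is the colour
  -- of legᵢ (another spoke at vᵢ would clash with e′ at u).
  squeezed⇒WColour : ∀ {e e′ i j} → ends e ≡ spoke i → ends e′ ≡ spoke j → i ≢ j →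
    Between (c e) (c e′) (c (legᵢ i)) → WColour (c e′)
  squeezed⇒WColour {e} {e′} {i} e≡spoke e′≡spoke i≢j between
    with interval-between (incident-by-ends e≡spoke (inj₂ refl))
                          (incident-by-ends (proj₂ (legEdge i)) (inj₁ refl)) between
  ... | h , h-at-vᵢ , ch≡ce′ with at-v h i h-at-vᵢ
  ...   | inj₂ h≡leg   = h , incident-by-ends h≡leg (inj₂ refl) , ch≡ce′
  ...   | inj₁ h≡spoke = ⊥-elim (proper h e′ parU h≢e′ (incident-by-ends h≡spoke (inj₁ refl))
                                       (incident-by-ends e′≡spoke (inj₁ refl)) ch≡ce′)
    where
    h≢e′ : h ≢ e′
    h≢e′ = distinct-by-ends λ ends≡ → i≢j (parV-injective (cong proj₂ (trans (sym h≡spoke) (trans ends≡ e′≡spoke))))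

  Low High : E → Set
  Low e  = Incident G e parU × (∀ f → Incident G f parW → c e < c f)
  High e = Incident G e parU × (∀ f → Incident G f parW → c f < c e)

  low? : Decidable Low
  low? e = incident? G parU e ×-dec Fin.all? (λ f → incident? G parW f →-dec (c e <? c f))

  high? : Decidable High
  high? e = incident? G parU e ×-dec Fin.all? (λ f → incident? G parW f →-dec (c f <? c e))

  low-not-WColour : ∀ {e} → Low e → ¬ WColour (c e)
  low-not-WColour (_ , below) (f , f-at-w , cf≡ce) = <-irrefl (sym cf≡ce) (below f f-at-w)

  high-not-WColour : ∀ {e} → High e → ¬ WColour (c e)
  high-not-WColour (_ , above) (f , f-at-w , cf≡ce) = <-irrefl cf≡ce (above f f-at-w)

  SameEnd : (E → Set) → Set
  SameEnd P = ∀ {e e′ i j} → P e → P e′ → ends e ≡ spoke i → ends e′ ≡ spoke j → i ≡ j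

  -- Two low spokes to distinct vᵢ, vⱼ would squeeze one between the other
  -- and a leg; likewise for high spokes.
  low-same-end : SameEnd Low
  low-same-end {e} {e′} {i} {j} low low′ e≡ e′≡ with i Fin.≟ j | ≤-total (c e) (c e′)
  ... | yes i≡j | _ = i≡j
  ... | no i≢j | inj₁ ce≤ce′ = ⊥-elim (low-not-WColour low′
        (squeezed⇒WColour e≡ e′≡ i≢j (inj₁ (ce≤ce′ , <⇒≤ (proj₂ low′ _ (legᵢ-at-w i))))))
  ... | no i≢j | inj₂ ce′≤ce = ⊥-elim (low-not-WColour low
        (squeezed⇒WColour e′≡ e≡ (i≢j ∘ sym) (inj₁ (ce′≤ce , <⇒≤ (proj₂ low _ (legᵢ-at-w j))))))

  high-same-end : SameEnd High
  high-same-end {e} {e′} {i} {j} high high′ e≡ e′≡ with i Fin.≟ j | ≤-total (c e′) (c e)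
  ... | yes i≡j | _ = i≡j
  ... | no i≢j | inj₁ ce′≤ce = ⊥-elim (high-not-WColour high′
        (squeezed⇒WColour e≡ e′≡ i≢j (inj₂ (<⇒≤ (proj₂ high′ _ (legᵢ-at-w i)) , ce′≤ce))))
  ... | no i≢j | inj₂ ce≤ce′ = ⊥-elim (high-not-WColour high
        (squeezed⇒WColour e′≡ e≡ (i≢j ∘ sym) (inj₂ (<⇒≤ (proj₂ high _ (legᵢ-at-w j)) , ce≤ce′))))

  -- A decidable class of spokes with a common end has a named common end
  -- (any vertex serves when the class is empty).
  common-end : (P : E → Set) → Decidable P → (∀ {e} → P e → Incident G e parU) → SameEnd P →
    Fin n → ∃ λ i → ∀ e → P e → ends e ≡ spoke i
  common-end P P? at-u′ same default with Fin.any? P?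
  ... | no none = default , λ e pe → ⊥-elim (none (e , pe))
  ... | yes (e₀ , pe₀) with at-u e₀ (at-u′ pe₀)
  ...   | i₀ , e₀≡ = i₀ , λ e pe → end-of e pe
    where
    end-of : ∀ e → P e → ends e ≡ spoke i₀
    end-of e pe with at-u e (at-u′ pe)
    ... | j , e≡ = subst (λ k → ends e ≡ spoke k) (same pe pe₀ e≡ e₀≡) e≡

  middle⇒WColour : ∀ e → Incident G e parU → ¬ Low e → ¬ High e → WColour (c e)
  middle⇒WColour e e-at-u not-low not-high
    with counterexample (incident? G parW) (λ f → c e <? c f) (not-low ∘ (e-at-u ,_))
       | counterexample (incident? G parW) (λ f → c f <? c e) (not-high ∘ (e-at-u ,_))
  ... | f , f-at-w , ce≮cf | f′ , f′-at-w , cf′≮ce =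
    interval-between f-at-w f′-at-w (inj₁ (≮⇒≥ ce≮cf , ≮⇒≥ cf′≮ce))

  spokeColours : Fin n → List ℕ
  spokeColours i = map c (edgesWhere G (_≟ spoke i))

  wColours : List ℕ
  wColours = coloursAt G c parW

  spoke-colour∈ : ∀ {e i} → ends e ≡ spoke i → c e ∈ spokeColours i
  spoke-colour∈ {e} {i} e≡ = ∈-map⁺ c (∈-filter⁺ (_≟ spoke i ∘ ends) (∈-allFin e) e≡)

  spokeColours-pair : ∀ {k x} i j → k ≡ i ⊎ k ≡ j → x ∈ spokeColours k →
    x ∈ spokeColours i ++ spokeColours j ++ wColours
  spokeColours-pair i j (inj₁ refl) x∈ = ∈-++⁺ˡ x∈
  spokeColours-pair i j (inj₂ refl) x∈ = ∈-++⁺ʳ (spokeColours i) (∈-++⁺ˡ x∈)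

  spokeColours≤ : ∀ i → length (spokeColours i) ≤ r i
  spokeColours≤ i = ≤-trans (≤-reflexive (trans (length-map c (edgesWhere G (_≟ spoke i)))
                                                (length-edgesWhere G (_≟ spoke i))))
                            (spoke-multiplicity i)

  wColours≤n : length wColours ≤ n
  wColours≤n = ≤-trans (≤-reflexive (trans (length-map c (edgesAt G parW)) (length-edgesWhere G (touches? parW))))
                       deg-w≤n

  sum≤coloursAt-u : sum (map r (allFin n)) ≤ length (coloursAt G c parU)
  sum≤coloursAt-u = ≤-trans sum≤deg-u (≤-reflexive (sym (trans (length-map c (edgesAt G parU))
                                                                (length-edgesWhere G (touches? parU)))))

  coloursAt-u-covered : (lo hi i j : Fin n) → lo ≡ i ⊎ lo ≡ j → hi ≡ i ⊎ hi ≡ j →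
    (∀ e → Low e → ends e ≡ spoke lo) → (∀ e → High e → ends e ≡ spoke hi) →
    coloursAt G c parU ⊆ spokeColours i ++ spokeColours j ++ wColours
  coloursAt-u-covered lo hi i j lo∈ hi∈ low-end high-end k∈ with ∈-map⁻ c k∈
  ... | e , e∈ , refl with proj₂ (∈-filter⁻ (incident? G parU) {xs = allFin _} e∈)
  ... | e-at-u with low? e | high? e
  ... | yes low    | _           = spokeColours-pair i j lo∈ (spoke-colour∈ (low-end e low))
  ... | no _       | yes high    = spokeColours-pair i j hi∈ (spoke-colour∈ (high-end e high))
  ... | no not-low | no not-high with middle⇒WColour e e-at-u not-low not-high
  ...   | f , f-at-w , cf≡ce = subst (_∈ spokeColours i ++ spokeColours j ++ wColours) cf≡ce
          (∈-++⁺ʳ (spokeColours i) (∈-++⁺ʳ (spokeColours j) (colour∈coloursAt f-at-w)))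

  colour-count : (lo hi i j : Fin n) → lo ≡ i ⊎ lo ≡ j → hi ≡ i ⊎ hi ≡ j →
    (∀ e → Low e → ends e ≡ spoke lo) → (∀ e → High e → ends e ≡ spoke hi) →
    sum (map r (allFin n)) ≤ r i + (r j + n)
  colour-count lo hi i j lo∈ hi∈ low-end high-end = begin
      sum (map r (allFin n))                                  ≤⟨ sum≤coloursAt-u ⟩
      length (coloursAt G c parU)                             ≤⟨ unique⊆⇒length≤ (coloursAt-unique parU)
                                                                   (coloursAt-u-covered lo hi i j lo∈ hi∈ low-end high-end) ⟩
      length (spokeColours i ++ spokeColours j ++ wColours)   ≡⟨ trans (length-++ (spokeColours i)) (cong (length (spokeColours i) +_) (length-++ (spokeColours j))) ⟩
      length (spokeColours i) + (length (spokeColours j) + length wColours)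
                                                              ≤⟨ +-mono-≤ (spokeColours≤ i) (+-mono-≤ (spokeColours≤ j) wColours≤n) ⟩
      r i + (r j + n)                                         ∎
    where open ≤-Reasoning

antitone-pair : ∀ {k} (r : Fin (suc (suc k)) → ℕ) → (∀ i j → toℕ i ≤ toℕ j → r j ≤ r i) →
  ∀ {i j} → i ≢ j → r i + r j ≤ r fzero + r (fsuc fzero)
antitone-pair r antitone {i} {j} i≢j with <-cmp (toℕ i) (toℕ j)
... | tri< i<j _ _ = +-mono-≤ (antitone fzero i z≤n) (antitone (fsuc fzero) j (≤-trans (s≤s z≤n) i<j))
... | tri≈ _ i≡j _ = ⊥-elim (i≢j (Fin.toℕ-injective i≡j))
... | tri> _ _ j<i = ≤-trans (≤-reflexive (+-comm (r i) (r j)))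
                       (+-mono-≤ (antitone fzero j z≤n) (antitone (fsuc fzero) i (≤-trans (s≤s z≤n) j<i)))

two-element-cover : ∀ {k} (a b : Fin (suc (suc k))) →
  ∃ λ i → ∃ λ j → i ≢ j × (a ≡ i ⊎ a ≡ j) × (b ≡ i ⊎ b ≡ j)
two-element-cover a b with a Fin.≟ b
... | no a≢b = a , b , a≢b , inj₁ refl , inj₂ refl
... | yes refl with a Fin.≟ fzero
...   | yes refl = fzero , fsuc fzero , (λ ()) , inj₁ refl , inj₁ refl
...   | no a≢0   = a , fzero , a≢0 , inj₁ refl , inj₁ refl

excess-bound : ∀ a b s x y m → a + (b + s) ≤ x + (y + m) → x + y ≤ a + b → s ≤ m
excess-bound a b s x y m total pair = +-cancelˡ-≤ (a + b) s m (begin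
    a + b + s     ≡⟨ +-assoc a b s ⟩
    a + (b + s)   ≤⟨ total ⟩
    x + (y + m)   ≡⟨ sym (+-assoc x y m) ⟩
    x + y + m     ≤⟨ +-monoˡ-≤ m pair ⟩
    a + b + m     ∎)
  where open ≤-Reasoning

theorem15 : (n : ℕ) (r : Fin n → ℕ) → 3 ≤ n →
    (∀ i j → toℕ i ≤ toℕ j → r j ≤ r i) → (∀ i → 1 ≤ r i) →
    n + 1 ≤ sum (map r (drop 2 (allFin n))) →
    ¬ InN (Par n r)
theorem15 n@(suc (suc (suc _))) r _ antitone _ heavy (_ , _ , _ , IC) =
  m+1+n≰m n (≤-trans heavy light)
  where
  open ParachuteEdges n r using (spoke)
  open ParachuteColouring n r IC
  lows : ∃ λ lo → ∀ e → Low e → ends e ≡ spoke lo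
  lows = common-end Low low? proj₁ low-same-end fzero
  highs : ∃ λ hi → ∀ e → High e → ends e ≡ spoke hi
  highs = common-end High high? proj₁ high-same-end fzero

  light : sum (map r (drop 2 (allFin n))) ≤ n
  light with two-element-cover (proj₁ lows) (proj₁ highs)
  ... | i , j , i≢j , lo∈ , hi∈ =
    excess-bound (r fzero) (r (fsuc fzero)) _ (r i) (r j) n
      (colour-count (proj₁ lows) (proj₁ highs) i j lo∈ hi∈ (proj₂ lows) (proj₂ highs))
      (antitone-pair r antitone i≢j)
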